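{- For every non-negative integer $k$, the checkerboard graph $G_{4,6k+4}$ admits no graph derangement of cycle type $(6,6,\dots,6,4)$ (i.e., consisting of cycles of length $6$ together with exactly one cycle of length $4$). Consequently these graphs are not even universal.
   Context: For positive integers $m,n$, $G_{m,n}$ denotes the checkerboard graph (also written $R_{m,n}$): vertex set $\{1,\dots,m\}\times\{1,\dots,n\}$, with $(x_1,x_2)$ adjacent to $(y_1,y_2)$ iff $|x_1-y_1|+|x_2-y_2|=1$. A graph derangement of a graph $G=(V,E)$ is an injective map $f:V\to V$ with $f(v)$ adjacent to $v$ for all $v$. For a finite graph, the cycles of $f$ are its orbits, and the cycle type of $f$ is the partition of $\#V$ given by the multiset of cycle sizes. A finite graph with $N$ vertices is even universal if every partition of $N$ into even parts is the cycle type of some graph derangement of it. -}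

module Defs where

open import Data.Nat using (ℕ; zero; suc; _+_; _*_; _≤_; _<_; ∣_-_∣)
open import Data.Nat.Divisibility using (_∣_)
open import Data.Fin using (Fin; toℕ)
open import Data.Product using (Σ; ∃; _×_; _,_; proj₁; proj₂)
open import Data.Nat.ListAction using (sum)
open import Data.List using (List; map; replicate; _++_; _∷_; [])
open import Data.List.Membership.Propositional using (_∈_)
open import Data.List.Relation.Unary.All using (All)
open import Data.List.Relation.Unary.AllPairs using (AllPairs)
open import Data.List.Relation.Binary.Permutation.Propositional using (_↭_)
open import Relation.Binary.PropositionalEquality using (_≡_)
open import Relation.Nullary using (¬_)
open import Function.Definitions using (Injective)

iter : {V : Set} → (V → V) → ℕ → V → V
iter f zero v = v
iter f (suc t) v = f (iter f t v)

record GraphDerangement (V : Set) (Adj : V → V → Set) : Set where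
  field
    fun : V → V
    inj : Injective _≡_ _≡_ fun
    adj : ∀ v → Adj v (fun v)
open GraphDerangement public

CycleLength : {V : Set} → (V → V) → V → ℕ → Set
CycleLength f v s = (1 ≤ s) × (iter f s v ≡ v) × (∀ t → 1 ≤ t → t < s → ¬ (iter f t v ≡ v))

SameOrbit : {V : Set} → (V → V) → V → V → Set
SameOrbit f u v = ∃ λ t → iter f t u ≡ v

-- f has cycle type λ: there is a list of (representative, cycle length) pairs,
-- one per cycle (every vertex lies in the orbit of some representative,
-- distinct representatives lie in distinct orbits), whose lengths form λ
-- as a multiset.
HasCycleType : {V : Set} → (V → V) → List ℕ → Set
HasCycleType {V} f λs = Σ (List (V × ℕ)) λ reps →
    All (λ p → CycleLength f (proj₁ p) (proj₂ p)) reps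
  × (∀ v → ∃ λ p → (p ∈ reps) × SameOrbit f (proj₁ p) v)
  × AllPairs (λ p q → ¬ SameOrbit f (proj₁ p) (proj₁ q)) reps
  × (map proj₂ reps ↭ λs)

Vtx : ℕ → ℕ → Set
Vtx m n = Fin m × Fin n

GAdj : (m n : ℕ) → Vtx m n → Vtx m n → Set
GAdj m n (x₁ , x₂) (y₁ , y₂) = ∣ toℕ x₁ - toℕ y₁ ∣ + ∣ toℕ x₂ - toℕ y₂ ∣ ≡ 1

EvenUniversal : (m n : ℕ) → Set
EvenUniversal m n = (λs : List ℕ) → All (λ p → (1 ≤ p) × (2 ∣ p)) λs → sum λs ≡ m * n →
  Σ (GraphDerangement (Vtx m n) (GAdj m n)) λ f → HasCycleType (fun f) λs

-- the partition (6,6,...,6,4) of 4(6k+4) = 24k+16: 4k+2 sixes and one four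
sixesAndFour : ℕ → List ℕ
sixesAndFour k = replicate (4 * k + 2) 6 ++ (4 ∷ [])

-- A cycle of a graph derangement is a closed walk in the grid that never steps straight
-- back, so a 4-cycle runs around a unit square and a 6-cycle around a 2×3 or 3×2
-- rectangle: a derangement of G_{4,n} of type (6,…,6,4) is a tiling of the 4×n board by
-- one square and such rectangles. A vertical 3×2 tile covers three of the four rows, and
-- the cell left over in its column could only be tiled by a tile reaching into it, so
-- every other tile is horizontal. A row avoiding the square is then cut into blocks of
-- three columns, forcing 3 ∣ n; as 3 ∤ 6k + 4, the square meets both the top and the
-- bottom row, which it cannot.
module Submission where

open import Defs
open import Data.Empty using (⊥; ⊥-elim)
open import Data.Fin using (Fin; toℕ; fromℕ<; #_; zero)
open import Data.Fin.Properties using (toℕ-injective; toℕ<n; toℕ-fromℕ<; ¬∀⟶∃¬)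
open import Data.List using (List; []; _∷_; _++_; map; replicate; filter; length)
open import Data.List.Membership.Propositional using (_∈_)
open import Data.List.Membership.Propositional.Properties using (∈-map⁺; ∈-filter⁺)
open import Data.List.Properties using (filter-accept; filter-reject)
open import Data.List.Relation.Binary.Permutation.Propositional using (_↭_)
open import Data.List.Relation.Binary.Permutation.Propositional.Properties using (∈-resp-↭; ↭-length; filter-↭)
open import Data.List.Relation.Unary.All as All using (All)
open import Data.List.Relation.Unary.All.Properties using (++⁺; replicate⁺)
open import Data.List.Relation.Unary.Any using (here; there)
open import Data.Nat using (ℕ; zero; suc; _+_; _*_; _∸_; _≤_; _<_; z≤n; s≤s; _≟_; _≤?_; _<?_; ∣_-_∣)
open import Data.Nat.DivMod using (_%_; _/_; m≡m%n+[m/n]*n; m%n<n)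
open import Data.Nat.Divisibility using (_∣_; _∣?_; divides; _∣0; n∣n; ∣m∣n⇒∣m+n; ∣m+n∣m⇒∣n; ∣-trans; m∣m*n)
open import Data.Nat.ListAction using (sum)
open import Data.Nat.Properties
open import Data.Nat.Solver using (module +-*-Solver)
open import Data.Product using (Σ; ∃; ∃₂; _×_; _,_; proj₁; proj₂)
open import Data.Sum using (_⊎_; inj₁; inj₂)
open import Function using (_∘_; case_of_)
open import Relation.Binary.PropositionalEquality using (_≡_; _≢_; refl; sym; trans; cong; cong₂; subst; module ≡-Reasoning)
open import Relation.Binary.Definitions using (tri<; tri≈; tri>)
open import Relation.Nullary using (¬_; Dec; yes; no)
open import Relation.Nullary.Decidable using (True; toWitness; decidable-stable)

module _ {V : Set} (F : V → V) where
  open ≡-Reasoning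

  iter-+ : ∀ a b x → iter F (a + b) x ≡ iter F a (iter F b x)
  iter-+ zero    b x = refl
  iter-+ (suc a) b x = cong F (iter-+ a b x)

  iter-comm : ∀ a b x → iter F a (iter F b x) ≡ iter F b (iter F a x)
  iter-comm a b x = begin
    iter F a (iter F b x)  ≡⟨ iter-+ a b x ⟨
    iter F (a + b) x       ≡⟨ cong (λ t → iter F t x) (+-comm a b) ⟩
    iter F (b + a) x       ≡⟨ iter-+ b a x ⟩
    iter F b (iter F a x)  ∎

  iter-*-period : ∀ {s v} → iter F s v ≡ v → ∀ q → iter F (q * s) v ≡ v
  iter-*-period e zero = refl
  iter-*-period {s} {v} e (suc q) = begin
    iter F (s + q * s) v    ≡⟨ iter-+ s (q * s) v ⟩
    iter F s (iter F (q * s) v) ≡⟨ cong (iter F s) (iter-*-period e q) ⟩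
    iter F s v              ≡⟨ e ⟩
    v                       ∎

  iter-mod : ∀ {v s} → CycleLength F v s → ∀ t → ∃ λ i → i < s × iter F t v ≡ iter F i v
  iter-mod {v} {suc s-1} (_ , period , _) t = t % s , m%n<n t s , (begin
    iter F t v                          ≡⟨ cong (λ k → iter F k v) (m≡m%n+[m/n]*n t s) ⟩
    iter F (t % s + t / s * s) v        ≡⟨ iter-+ (t % s) (t / s * s) v ⟩
    iter F (t % s) (iter F (t / s * s) v) ≡⟨ cong (iter F (t % s)) (iter-*-period period (t / s)) ⟩
    iter F (t % s) v                    ∎)
    where
    s : ℕ
    s = suc s-1

  orbit-sym : ∀ {u v s} → CycleLength F u s → SameOrbit F u v → SameOrbit F v u
  orbit-sym {u} {s = s} cyc@(_ , period , _) (t , refl) with iter-mod cyc t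
  ... | i , i<s , e = s ∸ i , (begin
    iter F (s ∸ i) (iter F t u)  ≡⟨ cong (iter F (s ∸ i)) e ⟩
    iter F (s ∸ i) (iter F i u)  ≡⟨ iter-+ (s ∸ i) i u ⟨
    iter F (s ∸ i + i) u         ≡⟨ cong (λ k → iter F k u) (m∸n+n≡m (<⇒≤ i<s)) ⟩
    iter F s u                   ≡⟨ period ⟩
    u                            ∎)

  orbit-trans : ∀ {u v w} → SameOrbit F u v → SameOrbit F v w → SameOrbit F u w
  orbit-trans {u} (t , refl) (t' , refl) = t' + t , iter-+ t' t u

  cycleLength-transfer : ∀ {u v s} → CycleLength F u s → SameOrbit F u v → CycleLength F v s
  cycleLength-transfer {u} {s = s} cyc@(1≤s , period , minimal) (t , refl) =
    1≤s , trans (iter-comm s t u) (cong (iter F t) period) , shorter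
    where
    shorter : ∀ t' → 1 ≤ t' → t' < s → iter F t' (iter F t u) ≢ iter F t u
    shorter t' 1≤t' t'<s e with orbit-sym cyc (t , refl)
    ... | r , back = minimal t' 1≤t' t'<s (begin
      iter F t' u                         ≡⟨ cong (iter F t') back ⟨
      iter F t' (iter F r (iter F t u))   ≡⟨ iter-comm t' r _ ⟩
      iter F r (iter F t' (iter F t u))   ≡⟨ cong (iter F r) e ⟩
      iter F r (iter F t u)               ≡⟨ back ⟩
      u                                   ∎)

  cycleLength-unique : ∀ {v s s'} → CycleLength F v s → CycleLength F v s' → s ≡ s'
  cycleLength-unique (1≤s , period , minimal) (1≤s' , period' , minimal') with <-cmp _ _
  ... | tri< s<s' _ _ = ⊥-elim (minimal' _ 1≤s s<s' period)
  ... | tri≈ _ s≡s' _ = s≡s'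
  ... | tri> _ _ s'<s = ⊥-elim (minimal _ 1≤s' s'<s period')

  orbit-distinct : ∀ {v s i j} → CycleLength F v s → i < j → j < s → iter F i v ≢ iter F j v
  orbit-distinct {v} {s} {i} {j} (_ , period , minimal) i<j j<s e =
    minimal (s ∸ j + i) (≤-trans (m<n⇒0<n∸m j<s) (m≤m+n _ i)) gap (begin
      iter F (s ∸ j + i) v          ≡⟨ iter-+ (s ∸ j) i v ⟩
      iter F (s ∸ j) (iter F i v)   ≡⟨ cong (iter F (s ∸ j)) e ⟩
      iter F (s ∸ j) (iter F j v)   ≡⟨ iter-+ (s ∸ j) j v ⟨
      iter F (s ∸ j + j) v          ≡⟨ cong (λ k → iter F k v) (m∸n+n≡m (<⇒≤ j<s)) ⟩
      iter F s v                    ≡⟨ period ⟩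
      v                             ∎)
    where
    gap : s ∸ j + i < s
    gap = subst (s ∸ j + i <_) (m∸n+n≡m (<⇒≤ j<s)) (+-monoʳ-< (s ∸ j) i<j)

module _ {n : ℕ} (start : ∀ c → c < n → ℕ)
         (start≤ : ∀ c p → start c p ≤ c)
         (≤start+2 : ∀ c p → c ≤ 2 + start c p)
         (block<n : ∀ c p → 2 + start c p < n)
         (block-start : ∀ c c' p p' → start c p ≤ c' → c' ≤ 2 + start c p → start c' p' ≡ start c p)
  where

  private
    next-block : ∀ c p p' → ¬ start (suc c) p' ≤ c → suc c ≡ 3 + start c p
    next-block c p p' beyond = ≤-antisym (s≤s (≤start+2 c p)) (≰⇒> inside)
      where
      inside : ¬ suc c ≤ 2 + start c p
      inside le = beyond (subst (_≤ c) (sym (block-start c (suc c) p p' (m≤n⇒m≤1+n (start≤ c p)) le)) (start≤ c p))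

    3∣start : ∀ c p → 3 ∣ start c p
    3∣start zero    p = subst (3 ∣_) (sym (n≤0⇒n≡0 (start≤ 0 p))) (3 ∣0)
    3∣start (suc c) p' with start (suc c) p' ≤? c
    ... | yes within = subst (3 ∣_) (block-start (suc c) c p' (<⇒≤ p') within (≤-trans (n≤1+n c) (≤start+2 (suc c) p')))
                             (3∣start c (<⇒≤ p'))
    ... | no beyond = subst (3 ∣_) (sym (trans new-start (next-block c (<⇒≤ p') p' beyond))) (∣m∣n⇒∣m+n n∣n (3∣start c (<⇒≤ p')))
      where
      new-start : start (suc c) p' ≡ suc c
      new-start = ≤-antisym (start≤ (suc c) p') (≰⇒> beyond)

    width-divisible : ∀ w → w ≡ n → 3 ∣ n
    width-divisible zero    refl = 3 ∣0
    width-divisible (suc c) refl = subst (3 ∣_) (sym last-block) (∣m∣n⇒∣m+n n∣n (3∣start c ≤-refl))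
      where
      last-block : suc c ≡ 3 + start c ≤-refl
      last-block = cong suc (≤-antisym (≤start+2 c ≤-refl) (≤-pred (block<n c ≤-refl)))

  blocks-of-three⇒3∣n : 3 ∣ n
  blocks-of-three⇒3∣n = width-divisible n refl

data Shape : Set where
  square wide tall : Shape

wide? : ∀ s → Dec (s ≡ wide)
wide? square = no λ ()
wide? wide   = yes refl
wide? tall   = no λ ()

≢wide⇒≢tall⇒≡square : ∀ {s} → s ≢ wide → s ≢ tall → s ≡ square
≢wide⇒≢tall⇒≡square {square} _  _  = refl
≢wide⇒≢tall⇒≡square {wide}   ¬w _  = ⊥-elim (¬w refl)
≢wide⇒≢tall⇒≡square {tall}   _  ¬t = ⊥-elim (¬t refl)

-- The cells of the square, the 2×3 and the 3×2 rectangle with top-left cell (a , b);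
-- the first coordinate is the row.
data Cell : Shape → ℕ → ℕ → ℕ × ℕ → Set where
  sq-00 : ∀ {a b} → Cell square a b (a , b)
  sq-01 : ∀ {a b} → Cell square a b (a , suc b)
  sq-10 : ∀ {a b} → Cell square a b (suc a , b)
  sq-11 : ∀ {a b} → Cell square a b (suc a , suc b)
  wide-00 : ∀ {a b} → Cell wide a b (a , b)
  wide-01 : ∀ {a b} → Cell wide a b (a , suc b)
  wide-02 : ∀ {a b} → Cell wide a b (a , suc (suc b))
  wide-10 : ∀ {a b} → Cell wide a b (suc a , b)
  wide-11 : ∀ {a b} → Cell wide a b (suc a , suc b)
  wide-12 : ∀ {a b} → Cell wide a b (suc a , suc (suc b))
  tall-00 : ∀ {a b} → Cell tall a b (a , b)
  tall-01 : ∀ {a b} → Cell tall a b (a , suc b)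
  tall-10 : ∀ {a b} → Cell tall a b (suc a , b)
  tall-11 : ∀ {a b} → Cell tall a b (suc a , suc b)
  tall-20 : ∀ {a b} → Cell tall a b (suc (suc a) , b)
  tall-21 : ∀ {a b} → Cell tall a b (suc (suc a) , suc b)

record Rect : Set where
  constructor rect
  field
    shape : Shape
    row col : ℕ
open Rect

infix 4 _∋_
_∋_ : Rect → ℕ × ℕ → Set
R ∋ q = Cell (shape R) (row R) (col R) q

∋⇒Cell : ∀ {R s q} → shape R ≡ s → R ∋ q → Cell s (row R) (col R) q
∋⇒Cell {R} {q = q} e = subst (λ s → Cell s (row R) (col R) q) e

Cell⇒∋ : ∀ {R s q} → shape R ≡ s → Cell s (row R) (col R) q → R ∋ q
Cell⇒∋ e = ∋⇒Cell (sym e)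

∋-corner : ∀ R → R ∋ (row R , col R)
∋-corner (rect square _ _) = sq-00
∋-corner (rect wide   _ _) = wide-00
∋-corner (rect tall   _ _) = tall-00

corner≤ : ∀ {s a b x y} → Cell s a b (x , y) → a ≤ x × b ≤ y
corner≤ sq-00   = ≤-refl , ≤-refl
corner≤ sq-01   = ≤-refl , n≤1+n _
corner≤ sq-10   = n≤1+n _ , ≤-refl
corner≤ sq-11   = n≤1+n _ , n≤1+n _
corner≤ wide-00 = ≤-refl , ≤-refl
corner≤ wide-01 = ≤-refl , n≤1+n _
corner≤ wide-02 = ≤-refl , m≤n+m _ 2
corner≤ wide-10 = n≤1+n _ , ≤-refl
corner≤ wide-11 = n≤1+n _ , n≤1+n _
corner≤ wide-12 = n≤1+n _ , m≤n+m _ 2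
corner≤ tall-00 = ≤-refl , ≤-refl
corner≤ tall-01 = ≤-refl , n≤1+n _
corner≤ tall-10 = n≤1+n _ , ≤-refl
corner≤ tall-11 = n≤1+n _ , n≤1+n _
corner≤ tall-20 = m≤n+m _ 2 , ≤-refl
corner≤ tall-21 = m≤n+m _ 2 , n≤1+n _

shape-ext : ∀ {s s' a b} → (∀ {q} → Cell s a b q → Cell s' a b q) → (∀ {q} → Cell s' a b q → Cell s a b q) → s ≡ s'
shape-ext {square} {square} _ _ = refl
shape-ext {square} {wide}   _ ⊇ = case ⊇ wide-02 of λ ()
shape-ext {square} {tall}   _ ⊇ = case ⊇ tall-20 of λ ()
shape-ext {wide}   {square} ⊆ _ = case ⊆ wide-02 of λ ()
shape-ext {wide}   {wide}   _ _ = refl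
shape-ext {wide}   {tall}   ⊆ _ = case ⊆ wide-02 of λ ()
shape-ext {tall}   {square} ⊆ _ = case ⊆ tall-20 of λ ()
shape-ext {tall}   {wide}   ⊆ _ = case ⊆ tall-20 of λ ()
shape-ext {tall}   {tall}   _ _ = refl

rect-ext : ∀ {R R'} → (∀ {q} → R ∋ q → R' ∋ q) → (∀ {q} → R' ∋ q → R ∋ q) → R ≡ R'
rect-ext {rect s a b} {rect s' a' b'} ⊆ ⊇
  with ≤-antisym (proj₁ (corner≤ (⊇ (∋-corner (rect s' a' b'))))) (proj₁ (corner≤ (⊆ (∋-corner (rect s a b)))))
     | ≤-antisym (proj₂ (corner≤ (⊇ (∋-corner (rect s' a' b'))))) (proj₂ (corner≤ (⊆ (∋-corner (rect s a b)))))
... | refl | refl = cong (λ s → rect s a b) (shape-ext ⊆ ⊇)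

vertical-neighbour : ∀ {s a b x y} → Cell s a b (x , y) → (∃ λ x' → x ≡ suc x' × Cell s a b (x' , y)) ⊎ Cell s a b (suc x , y)
vertical-neighbour sq-00   = inj₂ sq-10
vertical-neighbour sq-01   = inj₂ sq-11
vertical-neighbour sq-10   = inj₁ (_ , refl , sq-00)
vertical-neighbour sq-11   = inj₁ (_ , refl , sq-01)
vertical-neighbour wide-00 = inj₂ wide-10
vertical-neighbour wide-01 = inj₂ wide-11
vertical-neighbour wide-02 = inj₂ wide-12
vertical-neighbour wide-10 = inj₁ (_ , refl , wide-00)
vertical-neighbour wide-11 = inj₁ (_ , refl , wide-01)
vertical-neighbour wide-12 = inj₁ (_ , refl , wide-02)
vertical-neighbour tall-00 = inj₂ tall-10
vertical-neighbour tall-01 = inj₂ tall-11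
vertical-neighbour tall-10 = inj₁ (_ , refl , tall-00)
vertical-neighbour tall-11 = inj₁ (_ , refl , tall-01)
vertical-neighbour tall-20 = inj₁ (_ , refl , tall-10)
vertical-neighbour tall-21 = inj₁ (_ , refl , tall-11)

wide-columns : ∀ {a b x y} → Cell wide a b (x , y) → b ≤ y × y ≤ 2 + b
wide-columns c = proj₂ (corner≤ c) , columns c
  where
  columns : ∀ {a b x y} → Cell wide a b (x , y) → y ≤ 2 + b
  columns wide-00 = m≤n+m _ 2
  columns wide-01 = s≤s (m≤n+m _ 1)
  columns wide-02 = ≤-refl
  columns wide-10 = m≤n+m _ 2
  columns wide-11 = s≤s (m≤n+m _ 1)
  columns wide-12 = ≤-refl

wide-row : ∀ {a b x y y'} → Cell wide a b (x , y) → b ≤ y' → y' ≤ 2 + b → Cell wide a b (x , y')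
wide-row {b = b} {x} {y' = y'} c b≤y' y'≤2+b =
  subst (λ z → Cell wide _ _ (x , z)) (m∸n+n≡m b≤y') (at-offset c offset≤2)
  where
  offset≤2 : y' ∸ b ≤ 2
  offset≤2 = subst (y' ∸ b ≤_) (m+n∸n≡m 2 b) (∸-monoˡ-≤ b y'≤2+b)
  top : ∀ {a b d} → d ≤ 2 → Cell wide a b (a , d + b)
  top z≤n             = wide-00
  top (s≤s z≤n)       = wide-01
  top (s≤s (s≤s z≤n)) = wide-02

  bottom : ∀ {a b d} → d ≤ 2 → Cell wide a b (suc a , d + b)
  bottom z≤n             = wide-10
  bottom (s≤s z≤n)       = wide-11
  bottom (s≤s (s≤s z≤n)) = wide-12

  at-offset : ∀ {a b x y d} → Cell wide a b (x , y) → d ≤ 2 → Cell wide a b (x , d + b)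
  at-offset wide-00 = top
  at-offset wide-01 = top
  at-offset wide-02 = top
  at-offset wide-10 = bottom
  at-offset wide-11 = bottom
  at-offset wide-12 = bottom

square-height : ∀ {a b y y'} → Cell square a b (0 , y) → ¬ Cell square a b (3 , y')
square-height sq-00 ()
square-height sq-01 ()

data Step : ℕ × ℕ → ℕ × ℕ → Set where
  east  : ∀ {x y} → Step (x , y) (x , suc y)
  west  : ∀ {x y} → Step (x , suc y) (x , y)
  south : ∀ {x y} → Step (x , y) (suc x , y)
  north : ∀ {x y} → Step (suc x , y) (x , y)

record NoReversal₄ (p0 p1 p2 p3 : ℕ × ℕ) : Set where
  field
    d02 : p0 ≢ p2
    d13 : p1 ≢ p3

data In₄ (p0 p1 p2 p3 : ℕ × ℕ) : ℕ × ℕ → Set where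
  i0 : In₄ p0 p1 p2 p3 p0
  i1 : In₄ p0 p1 p2 p3 p1
  i2 : In₄ p0 p1 p2 p3 p2
  i3 : In₄ p0 p1 p2 p3 p3

SquareThrough : (p0 p1 p2 p3 : ℕ × ℕ) → Set
SquareThrough p0 p1 p2 p3 = ∃₂ λ a b →
    (Cell square a b p0 × Cell square a b p1 × Cell square a b p2 × Cell square a b p3)
  × (∀ {q} → Cell square a b q → In₄ p0 p1 p2 p3 q)

-- Exhaustive split on the directions of the steps: the absurd clauses are walks that do
-- not close up, the ⊥-elim clauses walks that step straight back.
cycle₄⇒square : ∀ {p0 p1 p2 p3} → Step p0 p1 → Step p1 p2 → Step p2 p3 → Step p3 p0 →
                NoReversal₄ p0 p1 p2 p3 → SquareThrough p0 p1 p2 p3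
cycle₄⇒square east east east () d
cycle₄⇒square east east west _ d = ⊥-elim (NoReversal₄.d13 d refl)
cycle₄⇒square east east south () d
cycle₄⇒square east east north () d
cycle₄⇒square east west _ _ d = ⊥-elim (NoReversal₄.d02 d refl)
cycle₄⇒square east south east () d
cycle₄⇒square east south west north d = _ , _ , (sq-00 , sq-01 , sq-11 , sq-10) , (λ { sq-00 → i0; sq-01 → i1; sq-10 → i3; sq-11 → i2 })
cycle₄⇒square east south south () d
cycle₄⇒square east south north _ d = ⊥-elim (NoReversal₄.d13 d refl)
cycle₄⇒square east north east () d
cycle₄⇒square east north west south d = _ , _ , (sq-10 , sq-11 , sq-01 , sq-00) , (λ { sq-00 → i3; sq-01 → i2; sq-10 → i0; sq-11 → i1 })
cycle₄⇒square east north south _ d = ⊥-elim (NoReversal₄.d13 d refl)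
cycle₄⇒square east north north () d
cycle₄⇒square west east _ _ d = ⊥-elim (NoReversal₄.d02 d refl)
cycle₄⇒square west west east _ d = ⊥-elim (NoReversal₄.d13 d refl)
cycle₄⇒square west west west () d
cycle₄⇒square west west south () d
cycle₄⇒square west west north () d
cycle₄⇒square west south east north d = _ , _ , (sq-01 , sq-00 , sq-10 , sq-11) , (λ { sq-00 → i1; sq-01 → i0; sq-10 → i2; sq-11 → i3 })
cycle₄⇒square west south west () d
cycle₄⇒square west south south () d
cycle₄⇒square west south north _ d = ⊥-elim (NoReversal₄.d13 d refl)
cycle₄⇒square west north east south d = _ , _ , (sq-11 , sq-10 , sq-00 , sq-01) , (λ { sq-00 → i2; sq-01 → i3; sq-10 → i1; sq-11 → i0 })
cycle₄⇒square west north west () d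
cycle₄⇒square west north south _ d = ⊥-elim (NoReversal₄.d13 d refl)
cycle₄⇒square west north north () d
cycle₄⇒square south east east () d
cycle₄⇒square south east west _ d = ⊥-elim (NoReversal₄.d13 d refl)
cycle₄⇒square south east south () d
cycle₄⇒square south east north west d = _ , _ , (sq-00 , sq-10 , sq-11 , sq-01) , (λ { sq-00 → i0; sq-01 → i3; sq-10 → i1; sq-11 → i2 })
cycle₄⇒square south west east _ d = ⊥-elim (NoReversal₄.d13 d refl)
cycle₄⇒square south west west () d
cycle₄⇒square south west south () d
cycle₄⇒square south west north east d = _ , _ , (sq-01 , sq-11 , sq-10 , sq-00) , (λ { sq-00 → i3; sq-01 → i0; sq-10 → i2; sq-11 → i1 })
cycle₄⇒square south south east () d
cycle₄⇒square south south west () d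
cycle₄⇒square south south south () d
cycle₄⇒square south south north _ d = ⊥-elim (NoReversal₄.d13 d refl)
cycle₄⇒square south north _ _ d = ⊥-elim (NoReversal₄.d02 d refl)
cycle₄⇒square north east east () d
cycle₄⇒square north east west _ d = ⊥-elim (NoReversal₄.d13 d refl)
cycle₄⇒square north east south west d = _ , _ , (sq-10 , sq-00 , sq-01 , sq-11) , (λ { sq-00 → i1; sq-01 → i2; sq-10 → i0; sq-11 → i3 })
cycle₄⇒square north east north () d
cycle₄⇒square north west east _ d = ⊥-elim (NoReversal₄.d13 d refl)
cycle₄⇒square north west west () d
cycle₄⇒square north west south east d = _ , _ , (sq-11 , sq-01 , sq-00 , sq-10) , (λ { sq-00 → i2; sq-01 → i1; sq-10 → i3; sq-11 → i0 })
cycle₄⇒square north west north () d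
cycle₄⇒square north south _ _ d = ⊥-elim (NoReversal₄.d02 d refl)
cycle₄⇒square north north east () d
cycle₄⇒square north north west () d
cycle₄⇒square north north south _ d = ⊥-elim (NoReversal₄.d13 d refl)
cycle₄⇒square north north north () d

record NoReversal₆ (p0 p1 p2 p3 p4 p5 : ℕ × ℕ) : Set where
  field
    d02 : p0 ≢ p2
    d13 : p1 ≢ p3
    d24 : p2 ≢ p4
    d35 : p3 ≢ p5
    d04 : p0 ≢ p4
    d15 : p1 ≢ p5

data In₆ (p0 p1 p2 p3 p4 p5 : ℕ × ℕ) : ℕ × ℕ → Set where
  i0 : In₆ p0 p1 p2 p3 p4 p5 p0
  i1 : In₆ p0 p1 p2 p3 p4 p5 p1
  i2 : In₆ p0 p1 p2 p3 p4 p5 p2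
  i3 : In₆ p0 p1 p2 p3 p4 p5 p3
  i4 : In₆ p0 p1 p2 p3 p4 p5 p4
  i5 : In₆ p0 p1 p2 p3 p4 p5 p5

RectangleThrough : (p0 p1 p2 p3 p4 p5 : ℕ × ℕ) → Set
RectangleThrough p0 p1 p2 p3 p4 p5 = Σ Shape λ s → s ≢ square × ∃₂ λ a b →
    (Cell s a b p0 × Cell s a b p1 × Cell s a b p2 × Cell s a b p3 × Cell s a b p4 × Cell s a b p5)
  × (∀ {q} → Cell s a b q → In₆ p0 p1 p2 p3 p4 p5 q)

cycle₆⇒rectangle : ∀ {p0 p1 p2 p3 p4 p5} → Step p0 p1 → Step p1 p2 → Step p2 p3 → Step p3 p4 → Step p4 p5 → Step p5 p0 →
                   NoReversal₆ p0 p1 p2 p3 p4 p5 → RectangleThrough p0 p1 p2 p3 p4 p5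
cycle₆⇒rectangle east east east east east () d
cycle₆⇒rectangle east east east east west _ d = ⊥-elim (NoReversal₆.d35 d refl)
cycle₆⇒rectangle east east east east south () d
cycle₆⇒rectangle east east east east north () d
cycle₆⇒rectangle east east east west _ _ d = ⊥-elim (NoReversal₆.d24 d refl)
cycle₆⇒rectangle east east east south east () d
cycle₆⇒rectangle east east east south west () d
cycle₆⇒rectangle east east east south south () d
cycle₆⇒rectangle east east east south north _ d = ⊥-elim (NoReversal₆.d35 d refl)
cycle₆⇒rectangle east east east north east () d
cycle₆⇒rectangle east east east north west () d
cycle₆⇒rectangle east east east north south _ d = ⊥-elim (NoReversal₆.d35 d refl)
cycle₆⇒rectangle east east east north north () d
cycle₆⇒rectangle east east west _ _ _ d = ⊥-elim (NoReversal₆.d13 d refl)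
cycle₆⇒rectangle east east south east east () d
cycle₆⇒rectangle east east south east west _ d = ⊥-elim (NoReversal₆.d35 d refl)
cycle₆⇒rectangle east east south east south () d
cycle₆⇒rectangle east east south east north () d
cycle₆⇒rectangle east east south west east _ d = ⊥-elim (NoReversal₆.d35 d refl)
cycle₆⇒rectangle east east south west west north d = wide , (λ ()) , _ , _ , (wide-00 , wide-01 , wide-02 , wide-12 , wide-11 , wide-10) , (λ { wide-00 → i0; wide-01 → i1; wide-02 → i2; wide-10 → i5; wide-11 → i4; wide-12 → i3 })
cycle₆⇒rectangle east east south west south () d
cycle₆⇒rectangle east east south west north _ d = ⊥-elim (NoReversal₆.d15 d refl)
cycle₆⇒rectangle east east south south east () d
cycle₆⇒rectangle east east south south west () d
cycle₆⇒rectangle east east south south south () d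
cycle₆⇒rectangle east east south south north _ d = ⊥-elim (NoReversal₆.d35 d refl)
cycle₆⇒rectangle east east south north _ _ d = ⊥-elim (NoReversal₆.d24 d refl)
cycle₆⇒rectangle east east north east east () d
cycle₆⇒rectangle east east north east west _ d = ⊥-elim (NoReversal₆.d35 d refl)
cycle₆⇒rectangle east east north east south () d
cycle₆⇒rectangle east east north east north () d
cycle₆⇒rectangle east east north west east _ d = ⊥-elim (NoReversal₆.d35 d refl)
cycle₆⇒rectangle east east north west west south d = wide , (λ ()) , _ , _ , (wide-10 , wide-11 , wide-12 , wide-02 , wide-01 , wide-00) , (λ { wide-00 → i5; wide-01 → i4; wide-02 → i3; wide-10 → i0; wide-11 → i1; wide-12 → i2 })
cycle₆⇒rectangle east east north west south _ d = ⊥-elim (NoReversal₆.d15 d refl)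
cycle₆⇒rectangle east east north west north () d
cycle₆⇒rectangle east east north south _ _ d = ⊥-elim (NoReversal₆.d24 d refl)
cycle₆⇒rectangle east east north north east () d
cycle₆⇒rectangle east east north north west () d
cycle₆⇒rectangle east east north north south _ d = ⊥-elim (NoReversal₆.d35 d refl)
cycle₆⇒rectangle east east north north north () d
cycle₆⇒rectangle east west _ _ _ _ d = ⊥-elim (NoReversal₆.d02 d refl)
cycle₆⇒rectangle east south east east east () d
cycle₆⇒rectangle east south east east west _ d = ⊥-elim (NoReversal₆.d35 d refl)
cycle₆⇒rectangle east south east east south () d
cycle₆⇒rectangle east south east east north () d
cycle₆⇒rectangle east south east west _ _ d = ⊥-elim (NoReversal₆.d24 d refl)
cycle₆⇒rectangle east south east south east () d
cycle₆⇒rectangle east south east south west () d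
cycle₆⇒rectangle east south east south south () d
cycle₆⇒rectangle east south east south north _ d = ⊥-elim (NoReversal₆.d35 d refl)
cycle₆⇒rectangle east south east north east () d
cycle₆⇒rectangle east south east north west _ d = ⊥-elim (NoReversal₆.d15 d refl)
cycle₆⇒rectangle east south east north south _ d = ⊥-elim (NoReversal₆.d35 d refl)
cycle₆⇒rectangle east south east north north () d
cycle₆⇒rectangle east south west east _ _ d = ⊥-elim (NoReversal₆.d24 d refl)
cycle₆⇒rectangle east south west west east _ d = ⊥-elim (NoReversal₆.d35 d refl)
cycle₆⇒rectangle east south west west west () d
cycle₆⇒rectangle east south west west south () d
cycle₆⇒rectangle east south west west north east d = wide , (λ ()) , _ , _ , (wide-01 , wide-02 , wide-12 , wide-11 , wide-10 , wide-00) , (λ { wide-00 → i5; wide-01 → i0; wide-02 → i1; wide-10 → i4; wide-11 → i3; wide-12 → i2 })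
cycle₆⇒rectangle east south west south east () d
cycle₆⇒rectangle east south west south west () d
cycle₆⇒rectangle east south west south south () d
cycle₆⇒rectangle east south west south north _ d = ⊥-elim (NoReversal₆.d35 d refl)
cycle₆⇒rectangle east south west north _ _ d = ⊥-elim (NoReversal₆.d04 d refl)
cycle₆⇒rectangle east south south east east () d
cycle₆⇒rectangle east south south east west _ d = ⊥-elim (NoReversal₆.d35 d refl)
cycle₆⇒rectangle east south south east south () d
cycle₆⇒rectangle east south south east north () d
cycle₆⇒rectangle east south south west east _ d = ⊥-elim (NoReversal₆.d35 d refl)
cycle₆⇒rectangle east south south west west () d
cycle₆⇒rectangle east south south west south () d
cycle₆⇒rectangle east south south west north north d = tall , (λ ()) , _ , _ , (tall-00 , tall-01 , tall-11 , tall-21 , tall-20 , tall-10) , (λ { tall-00 → i0; tall-01 → i1; tall-10 → i5; tall-11 → i2; tall-20 → i4; tall-21 → i3 })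
cycle₆⇒rectangle east south south south east () d
cycle₆⇒rectangle east south south south west () d
cycle₆⇒rectangle east south south south south () d
cycle₆⇒rectangle east south south south north _ d = ⊥-elim (NoReversal₆.d35 d refl)
cycle₆⇒rectangle east south south north _ _ d = ⊥-elim (NoReversal₆.d24 d refl)
cycle₆⇒rectangle east south north _ _ _ d = ⊥-elim (NoReversal₆.d13 d refl)
cycle₆⇒rectangle east north east east east () d
cycle₆⇒rectangle east north east east west _ d = ⊥-elim (NoReversal₆.d35 d refl)
cycle₆⇒rectangle east north east east south () d
cycle₆⇒rectangle east north east east north () d
cycle₆⇒rectangle east north east west _ _ d = ⊥-elim (NoReversal₆.d24 d refl)
cycle₆⇒rectangle east north east south east () d
cycle₆⇒rectangle east north east south west _ d = ⊥-elim (NoReversal₆.d15 d refl)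
cycle₆⇒rectangle east north east south south () d
cycle₆⇒rectangle east north east south north _ d = ⊥-elim (NoReversal₆.d35 d refl)
cycle₆⇒rectangle east north east north east () d
cycle₆⇒rectangle east north east north west () d
cycle₆⇒rectangle east north east north south _ d = ⊥-elim (NoReversal₆.d35 d refl)
cycle₆⇒rectangle east north east north north () d
cycle₆⇒rectangle east north west east _ _ d = ⊥-elim (NoReversal₆.d24 d refl)
cycle₆⇒rectangle east north west west east _ d = ⊥-elim (NoReversal₆.d35 d refl)
cycle₆⇒rectangle east north west west west () d
cycle₆⇒rectangle east north west west south east d = wide , (λ ()) , _ , _ , (wide-11 , wide-12 , wide-02 , wide-01 , wide-00 , wide-10) , (λ { wide-00 → i4; wide-01 → i3; wide-02 → i2; wide-10 → i5; wide-11 → i0; wide-12 → i1 })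
cycle₆⇒rectangle east north west west north () d
cycle₆⇒rectangle east north west south _ _ d = ⊥-elim (NoReversal₆.d04 d refl)
cycle₆⇒rectangle east north west north east () d
cycle₆⇒rectangle east north west north west () d
cycle₆⇒rectangle east north west north south _ d = ⊥-elim (NoReversal₆.d35 d refl)
cycle₆⇒rectangle east north west north north () d
cycle₆⇒rectangle east north south _ _ _ d = ⊥-elim (NoReversal₆.d13 d refl)
cycle₆⇒rectangle east north north east east () d
cycle₆⇒rectangle east north north east west _ d = ⊥-elim (NoReversal₆.d35 d refl)
cycle₆⇒rectangle east north north east south () d
cycle₆⇒rectangle east north north east north () d
cycle₆⇒rectangle east north north west east _ d = ⊥-elim (NoReversal₆.d35 d refl)
cycle₆⇒rectangle east north north west west () d
cycle₆⇒rectangle east north north west south south d = tall , (λ ()) , _ , _ , (tall-20 , tall-21 , tall-11 , tall-01 , tall-00 , tall-10) , (λ { tall-00 → i4; tall-01 → i3; tall-10 → i5; tall-11 → i2; tall-20 → i0; tall-21 → i1 })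
cycle₆⇒rectangle east north north west north () d
cycle₆⇒rectangle east north north south _ _ d = ⊥-elim (NoReversal₆.d24 d refl)
cycle₆⇒rectangle east north north north east () d
cycle₆⇒rectangle east north north north west () d
cycle₆⇒rectangle east north north north south _ d = ⊥-elim (NoReversal₆.d35 d refl)
cycle₆⇒rectangle east north north north north () d
cycle₆⇒rectangle west east _ _ _ _ d = ⊥-elim (NoReversal₆.d02 d refl)
cycle₆⇒rectangle west west east _ _ _ d = ⊥-elim (NoReversal₆.d13 d refl)
cycle₆⇒rectangle west west west east _ _ d = ⊥-elim (NoReversal₆.d24 d refl)
cycle₆⇒rectangle west west west west east _ d = ⊥-elim (NoReversal₆.d35 d refl)
cycle₆⇒rectangle west west west west west () d
cycle₆⇒rectangle west west west west south () d
cycle₆⇒rectangle west west west west north () d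
cycle₆⇒rectangle west west west south east () d
cycle₆⇒rectangle west west west south west () d
cycle₆⇒rectangle west west west south south () d
cycle₆⇒rectangle west west west south north _ d = ⊥-elim (NoReversal₆.d35 d refl)
cycle₆⇒rectangle west west west north east () d
cycle₆⇒rectangle west west west north west () d
cycle₆⇒rectangle west west west north south _ d = ⊥-elim (NoReversal₆.d35 d refl)
cycle₆⇒rectangle west west west north north () d
cycle₆⇒rectangle west west south east east north d = wide , (λ ()) , _ , _ , (wide-02 , wide-01 , wide-00 , wide-10 , wide-11 , wide-12) , (λ { wide-00 → i2; wide-01 → i1; wide-02 → i0; wide-10 → i3; wide-11 → i4; wide-12 → i5 })
cycle₆⇒rectangle west west south east west _ d = ⊥-elim (NoReversal₆.d35 d refl)
cycle₆⇒rectangle west west south east south () d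
cycle₆⇒rectangle west west south east north _ d = ⊥-elim (NoReversal₆.d15 d refl)
cycle₆⇒rectangle west west south west east _ d = ⊥-elim (NoReversal₆.d35 d refl)
cycle₆⇒rectangle west west south west west () d
cycle₆⇒rectangle west west south west south () d
cycle₆⇒rectangle west west south west north () d
cycle₆⇒rectangle west west south south east () d
cycle₆⇒rectangle west west south south west () d
cycle₆⇒rectangle west west south south south () d
cycle₆⇒rectangle west west south south north _ d = ⊥-elim (NoReversal₆.d35 d refl)
cycle₆⇒rectangle west west south north _ _ d = ⊥-elim (NoReversal₆.d24 d refl)
cycle₆⇒rectangle west west north east east south d = wide , (λ ()) , _ , _ , (wide-12 , wide-11 , wide-10 , wide-00 , wide-01 , wide-02) , (λ { wide-00 → i3; wide-01 → i4; wide-02 → i5; wide-10 → i2; wide-11 → i1; wide-12 → i0 })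
cycle₆⇒rectangle west west north east west _ d = ⊥-elim (NoReversal₆.d35 d refl)
cycle₆⇒rectangle west west north east south _ d = ⊥-elim (NoReversal₆.d15 d refl)
cycle₆⇒rectangle west west north east north () d
cycle₆⇒rectangle west west north west east _ d = ⊥-elim (NoReversal₆.d35 d refl)
cycle₆⇒rectangle west west north west west () d
cycle₆⇒rectangle west west north west south () d
cycle₆⇒rectangle west west north west north () d
cycle₆⇒rectangle west west north south _ _ d = ⊥-elim (NoReversal₆.d24 d refl)
cycle₆⇒rectangle west west north north east () d
cycle₆⇒rectangle west west north north west () d
cycle₆⇒rectangle west west north north south _ d = ⊥-elim (NoReversal₆.d35 d refl)
cycle₆⇒rectangle west west north north north () d
cycle₆⇒rectangle west south east east east () d
cycle₆⇒rectangle west south east east west _ d = ⊥-elim (NoReversal₆.d35 d refl)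
cycle₆⇒rectangle west south east east south () d
cycle₆⇒rectangle west south east east north west d = wide , (λ ()) , _ , _ , (wide-01 , wide-00 , wide-10 , wide-11 , wide-12 , wide-02) , (λ { wide-00 → i1; wide-01 → i0; wide-02 → i5; wide-10 → i2; wide-11 → i3; wide-12 → i4 })
cycle₆⇒rectangle west south east west _ _ d = ⊥-elim (NoReversal₆.d24 d refl)
cycle₆⇒rectangle west south east south east () d
cycle₆⇒rectangle west south east south west () d
cycle₆⇒rectangle west south east south south () d
cycle₆⇒rectangle west south east south north _ d = ⊥-elim (NoReversal₆.d35 d refl)
cycle₆⇒rectangle west south east north _ _ d = ⊥-elim (NoReversal₆.d04 d refl)
cycle₆⇒rectangle west south west east _ _ d = ⊥-elim (NoReversal₆.d24 d refl)
cycle₆⇒rectangle west south west west east _ d = ⊥-elim (NoReversal₆.d35 d refl)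
cycle₆⇒rectangle west south west west west () d
cycle₆⇒rectangle west south west west south () d
cycle₆⇒rectangle west south west west north () d
cycle₆⇒rectangle west south west south east () d
cycle₆⇒rectangle west south west south west () d
cycle₆⇒rectangle west south west south south () d
cycle₆⇒rectangle west south west south north _ d = ⊥-elim (NoReversal₆.d35 d refl)
cycle₆⇒rectangle west south west north east _ d = ⊥-elim (NoReversal₆.d15 d refl)
cycle₆⇒rectangle west south west north west () d
cycle₆⇒rectangle west south west north south _ d = ⊥-elim (NoReversal₆.d35 d refl)
cycle₆⇒rectangle west south west north north () d
cycle₆⇒rectangle west south south east east () d
cycle₆⇒rectangle west south south east west _ d = ⊥-elim (NoReversal₆.d35 d refl)
cycle₆⇒rectangle west south south east south () d
cycle₆⇒rectangle west south south east north north d = tall , (λ ()) , _ , _ , (tall-01 , tall-00 , tall-10 , tall-20 , tall-21 , tall-11) , (λ { tall-00 → i1; tall-01 → i0; tall-10 → i2; tall-11 → i5; tall-20 → i3; tall-21 → i4 })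
cycle₆⇒rectangle west south south west east _ d = ⊥-elim (NoReversal₆.d35 d refl)
cycle₆⇒rectangle west south south west west () d
cycle₆⇒rectangle west south south west south () d
cycle₆⇒rectangle west south south west north () d
cycle₆⇒rectangle west south south south east () d
cycle₆⇒rectangle west south south south west () d
cycle₆⇒rectangle west south south south south () d
cycle₆⇒rectangle west south south south north _ d = ⊥-elim (NoReversal₆.d35 d refl)
cycle₆⇒rectangle west south south north _ _ d = ⊥-elim (NoReversal₆.d24 d refl)
cycle₆⇒rectangle west south north _ _ _ d = ⊥-elim (NoReversal₆.d13 d refl)
cycle₆⇒rectangle west north east east east () d
cycle₆⇒rectangle west north east east west _ d = ⊥-elim (NoReversal₆.d35 d refl)
cycle₆⇒rectangle west north east east south west d = wide , (λ ()) , _ , _ , (wide-11 , wide-10 , wide-00 , wide-01 , wide-02 , wide-12) , (λ { wide-00 → i2; wide-01 → i3; wide-02 → i4; wide-10 → i1; wide-11 → i0; wide-12 → i5 })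
cycle₆⇒rectangle west north east east north () d
cycle₆⇒rectangle west north east west _ _ d = ⊥-elim (NoReversal₆.d24 d refl)
cycle₆⇒rectangle west north east south _ _ d = ⊥-elim (NoReversal₆.d04 d refl)
cycle₆⇒rectangle west north east north east () d
cycle₆⇒rectangle west north east north west () d
cycle₆⇒rectangle west north east north south _ d = ⊥-elim (NoReversal₆.d35 d refl)
cycle₆⇒rectangle west north east north north () d
cycle₆⇒rectangle west north west east _ _ d = ⊥-elim (NoReversal₆.d24 d refl)
cycle₆⇒rectangle west north west west east _ d = ⊥-elim (NoReversal₆.d35 d refl)
cycle₆⇒rectangle west north west west west () d
cycle₆⇒rectangle west north west west south () d
cycle₆⇒rectangle west north west west north () d
cycle₆⇒rectangle west north west south east _ d = ⊥-elim (NoReversal₆.d15 d refl)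
cycle₆⇒rectangle west north west south west () d
cycle₆⇒rectangle west north west south south () d
cycle₆⇒rectangle west north west south north _ d = ⊥-elim (NoReversal₆.d35 d refl)
cycle₆⇒rectangle west north west north east () d
cycle₆⇒rectangle west north west north west () d
cycle₆⇒rectangle west north west north south _ d = ⊥-elim (NoReversal₆.d35 d refl)
cycle₆⇒rectangle west north west north north () d
cycle₆⇒rectangle west north south _ _ _ d = ⊥-elim (NoReversal₆.d13 d refl)
cycle₆⇒rectangle west north north east east () d
cycle₆⇒rectangle west north north east west _ d = ⊥-elim (NoReversal₆.d35 d refl)
cycle₆⇒rectangle west north north east south south d = tall , (λ ()) , _ , _ , (tall-21 , tall-20 , tall-10 , tall-00 , tall-01 , tall-11) , (λ { tall-00 → i3; tall-01 → i4; tall-10 → i2; tall-11 → i5; tall-20 → i1; tall-21 → i0 })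
cycle₆⇒rectangle west north north east north () d
cycle₆⇒rectangle west north north west east _ d = ⊥-elim (NoReversal₆.d35 d refl)
cycle₆⇒rectangle west north north west west () d
cycle₆⇒rectangle west north north west south () d
cycle₆⇒rectangle west north north west north () d
cycle₆⇒rectangle west north north south _ _ d = ⊥-elim (NoReversal₆.d24 d refl)
cycle₆⇒rectangle west north north north east () d
cycle₆⇒rectangle west north north north west () d
cycle₆⇒rectangle west north north north south _ d = ⊥-elim (NoReversal₆.d35 d refl)
cycle₆⇒rectangle west north north north north () d
cycle₆⇒rectangle south east east east east () d
cycle₆⇒rectangle south east east east west _ d = ⊥-elim (NoReversal₆.d35 d refl)
cycle₆⇒rectangle south east east east south () d
cycle₆⇒rectangle south east east east north () d
cycle₆⇒rectangle south east east west _ _ d = ⊥-elim (NoReversal₆.d24 d refl)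
cycle₆⇒rectangle south east east south east () d
cycle₆⇒rectangle south east east south west () d
cycle₆⇒rectangle south east east south south () d
cycle₆⇒rectangle south east east south north _ d = ⊥-elim (NoReversal₆.d35 d refl)
cycle₆⇒rectangle south east east north east () d
cycle₆⇒rectangle south east east north west west d = wide , (λ ()) , _ , _ , (wide-00 , wide-10 , wide-11 , wide-12 , wide-02 , wide-01) , (λ { wide-00 → i0; wide-01 → i5; wide-02 → i4; wide-10 → i1; wide-11 → i2; wide-12 → i3 })
cycle₆⇒rectangle south east east north south _ d = ⊥-elim (NoReversal₆.d35 d refl)
cycle₆⇒rectangle south east east north north () d
cycle₆⇒rectangle south east west _ _ _ d = ⊥-elim (NoReversal₆.d13 d refl)
cycle₆⇒rectangle south east south east east () d
cycle₆⇒rectangle south east south east west _ d = ⊥-elim (NoReversal₆.d35 d refl)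
cycle₆⇒rectangle south east south east south () d
cycle₆⇒rectangle south east south east north () d
cycle₆⇒rectangle south east south west east _ d = ⊥-elim (NoReversal₆.d35 d refl)
cycle₆⇒rectangle south east south west west () d
cycle₆⇒rectangle south east south west south () d
cycle₆⇒rectangle south east south west north _ d = ⊥-elim (NoReversal₆.d15 d refl)
cycle₆⇒rectangle south east south south east () d
cycle₆⇒rectangle south east south south west () d
cycle₆⇒rectangle south east south south south () d
cycle₆⇒rectangle south east south south north _ d = ⊥-elim (NoReversal₆.d35 d refl)
cycle₆⇒rectangle south east south north _ _ d = ⊥-elim (NoReversal₆.d24 d refl)
cycle₆⇒rectangle south east north east east () d
cycle₆⇒rectangle south east north east west _ d = ⊥-elim (NoReversal₆.d35 d refl)
cycle₆⇒rectangle south east north east south () d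
cycle₆⇒rectangle south east north east north () d
cycle₆⇒rectangle south east north west _ _ d = ⊥-elim (NoReversal₆.d04 d refl)
cycle₆⇒rectangle south east north south _ _ d = ⊥-elim (NoReversal₆.d24 d refl)
cycle₆⇒rectangle south east north north east () d
cycle₆⇒rectangle south east north north west south d = tall , (λ ()) , _ , _ , (tall-10 , tall-20 , tall-21 , tall-11 , tall-01 , tall-00) , (λ { tall-00 → i5; tall-01 → i4; tall-10 → i0; tall-11 → i3; tall-20 → i1; tall-21 → i2 })
cycle₆⇒rectangle south east north north south _ d = ⊥-elim (NoReversal₆.d35 d refl)
cycle₆⇒rectangle south east north north north () d
cycle₆⇒rectangle south west east _ _ _ d = ⊥-elim (NoReversal₆.d13 d refl)
cycle₆⇒rectangle south west west east _ _ d = ⊥-elim (NoReversal₆.d24 d refl)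
cycle₆⇒rectangle south west west west east _ d = ⊥-elim (NoReversal₆.d35 d refl)
cycle₆⇒rectangle south west west west west () d
cycle₆⇒rectangle south west west west south () d
cycle₆⇒rectangle south west west west north () d
cycle₆⇒rectangle south west west south east () d
cycle₆⇒rectangle south west west south west () d
cycle₆⇒rectangle south west west south south () d
cycle₆⇒rectangle south west west south north _ d = ⊥-elim (NoReversal₆.d35 d refl)
cycle₆⇒rectangle south west west north east east d = wide , (λ ()) , _ , _ , (wide-02 , wide-12 , wide-11 , wide-10 , wide-00 , wide-01) , (λ { wide-00 → i4; wide-01 → i5; wide-02 → i0; wide-10 → i3; wide-11 → i2; wide-12 → i1 })
cycle₆⇒rectangle south west west north west () d
cycle₆⇒rectangle south west west north south _ d = ⊥-elim (NoReversal₆.d35 d refl)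
cycle₆⇒rectangle south west west north north () d
cycle₆⇒rectangle south west south east east () d
cycle₆⇒rectangle south west south east west _ d = ⊥-elim (NoReversal₆.d35 d refl)
cycle₆⇒rectangle south west south east south () d
cycle₆⇒rectangle south west south east north _ d = ⊥-elim (NoReversal₆.d15 d refl)
cycle₆⇒rectangle south west south west east _ d = ⊥-elim (NoReversal₆.d35 d refl)
cycle₆⇒rectangle south west south west west () d
cycle₆⇒rectangle south west south west south () d
cycle₆⇒rectangle south west south west north () d
cycle₆⇒rectangle south west south south east () d
cycle₆⇒rectangle south west south south west () d
cycle₆⇒rectangle south west south south south () d
cycle₆⇒rectangle south west south south north _ d = ⊥-elim (NoReversal₆.d35 d refl)
cycle₆⇒rectangle south west south north _ _ d = ⊥-elim (NoReversal₆.d24 d refl)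
cycle₆⇒rectangle south west north east _ _ d = ⊥-elim (NoReversal₆.d04 d refl)
cycle₆⇒rectangle south west north west east _ d = ⊥-elim (NoReversal₆.d35 d refl)
cycle₆⇒rectangle south west north west west () d
cycle₆⇒rectangle south west north west south () d
cycle₆⇒rectangle south west north west north () d
cycle₆⇒rectangle south west north south _ _ d = ⊥-elim (NoReversal₆.d24 d refl)
cycle₆⇒rectangle south west north north east south d = tall , (λ ()) , _ , _ , (tall-11 , tall-21 , tall-20 , tall-10 , tall-00 , tall-01) , (λ { tall-00 → i4; tall-01 → i5; tall-10 → i3; tall-11 → i0; tall-20 → i2; tall-21 → i1 })
cycle₆⇒rectangle south west north north west () d
cycle₆⇒rectangle south west north north south _ d = ⊥-elim (NoReversal₆.d35 d refl)
cycle₆⇒rectangle south west north north north () d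
cycle₆⇒rectangle south south east east east () d
cycle₆⇒rectangle south south east east west _ d = ⊥-elim (NoReversal₆.d35 d refl)
cycle₆⇒rectangle south south east east south () d
cycle₆⇒rectangle south south east east north () d
cycle₆⇒rectangle south south east west _ _ d = ⊥-elim (NoReversal₆.d24 d refl)
cycle₆⇒rectangle south south east south east () d
cycle₆⇒rectangle south south east south west () d
cycle₆⇒rectangle south south east south south () d
cycle₆⇒rectangle south south east south north _ d = ⊥-elim (NoReversal₆.d35 d refl)
cycle₆⇒rectangle south south east north east () d
cycle₆⇒rectangle south south east north west _ d = ⊥-elim (NoReversal₆.d15 d refl)
cycle₆⇒rectangle south south east north south _ d = ⊥-elim (NoReversal₆.d35 d refl)
cycle₆⇒rectangle south south east north north west d = tall , (λ ()) , _ , _ , (tall-00 , tall-10 , tall-20 , tall-21 , tall-11 , tall-01) , (λ { tall-00 → i0; tall-01 → i5; tall-10 → i1; tall-11 → i4; tall-20 → i2; tall-21 → i3 })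
cycle₆⇒rectangle south south west east _ _ d = ⊥-elim (NoReversal₆.d24 d refl)
cycle₆⇒rectangle south south west west east _ d = ⊥-elim (NoReversal₆.d35 d refl)
cycle₆⇒rectangle south south west west west () d
cycle₆⇒rectangle south south west west south () d
cycle₆⇒rectangle south south west west north () d
cycle₆⇒rectangle south south west south east () d
cycle₆⇒rectangle south south west south west () d
cycle₆⇒rectangle south south west south south () d
cycle₆⇒rectangle south south west south north _ d = ⊥-elim (NoReversal₆.d35 d refl)
cycle₆⇒rectangle south south west north east _ d = ⊥-elim (NoReversal₆.d15 d refl)
cycle₆⇒rectangle south south west north west () d
cycle₆⇒rectangle south south west north south _ d = ⊥-elim (NoReversal₆.d35 d refl)
cycle₆⇒rectangle south south west north north east d = tall , (λ ()) , _ , _ , (tall-01 , tall-11 , tall-21 , tall-20 , tall-10 , tall-00) , (λ { tall-00 → i5; tall-01 → i0; tall-10 → i4; tall-11 → i1; tall-20 → i3; tall-21 → i2 })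
cycle₆⇒rectangle south south south east east () d
cycle₆⇒rectangle south south south east west _ d = ⊥-elim (NoReversal₆.d35 d refl)
cycle₆⇒rectangle south south south east south () d
cycle₆⇒rectangle south south south east north () d
cycle₆⇒rectangle south south south west east _ d = ⊥-elim (NoReversal₆.d35 d refl)
cycle₆⇒rectangle south south south west west () d
cycle₆⇒rectangle south south south west south () d
cycle₆⇒rectangle south south south west north () d
cycle₆⇒rectangle south south south south east () d
cycle₆⇒rectangle south south south south west () d
cycle₆⇒rectangle south south south south south () d
cycle₆⇒rectangle south south south south north _ d = ⊥-elim (NoReversal₆.d35 d refl)
cycle₆⇒rectangle south south south north _ _ d = ⊥-elim (NoReversal₆.d24 d refl)
cycle₆⇒rectangle south south north _ _ _ d = ⊥-elim (NoReversal₆.d13 d refl)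
cycle₆⇒rectangle south north _ _ _ _ d = ⊥-elim (NoReversal₆.d02 d refl)
cycle₆⇒rectangle north east east east east () d
cycle₆⇒rectangle north east east east west _ d = ⊥-elim (NoReversal₆.d35 d refl)
cycle₆⇒rectangle north east east east south () d
cycle₆⇒rectangle north east east east north () d
cycle₆⇒rectangle north east east west _ _ d = ⊥-elim (NoReversal₆.d24 d refl)
cycle₆⇒rectangle north east east south east () d
cycle₆⇒rectangle north east east south west west d = wide , (λ ()) , _ , _ , (wide-10 , wide-00 , wide-01 , wide-02 , wide-12 , wide-11) , (λ { wide-00 → i1; wide-01 → i2; wide-02 → i3; wide-10 → i0; wide-11 → i5; wide-12 → i4 })
cycle₆⇒rectangle north east east south south () d
cycle₆⇒rectangle north east east south north _ d = ⊥-elim (NoReversal₆.d35 d refl)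
cycle₆⇒rectangle north east east north east () d
cycle₆⇒rectangle north east east north west () d
cycle₆⇒rectangle north east east north south _ d = ⊥-elim (NoReversal₆.d35 d refl)
cycle₆⇒rectangle north east east north north () d
cycle₆⇒rectangle north east west _ _ _ d = ⊥-elim (NoReversal₆.d13 d refl)
cycle₆⇒rectangle north east south east east () d
cycle₆⇒rectangle north east south east west _ d = ⊥-elim (NoReversal₆.d35 d refl)
cycle₆⇒rectangle north east south east south () d
cycle₆⇒rectangle north east south east north () d
cycle₆⇒rectangle north east south west _ _ d = ⊥-elim (NoReversal₆.d04 d refl)
cycle₆⇒rectangle north east south south east () d
cycle₆⇒rectangle north east south south west north d = tall , (λ ()) , _ , _ , (tall-10 , tall-00 , tall-01 , tall-11 , tall-21 , tall-20) , (λ { tall-00 → i1; tall-01 → i2; tall-10 → i0; tall-11 → i3; tall-20 → i5; tall-21 → i4 })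
cycle₆⇒rectangle north east south south south () d
cycle₆⇒rectangle north east south south north _ d = ⊥-elim (NoReversal₆.d35 d refl)
cycle₆⇒rectangle north east south north _ _ d = ⊥-elim (NoReversal₆.d24 d refl)
cycle₆⇒rectangle north east north east east () d
cycle₆⇒rectangle north east north east west _ d = ⊥-elim (NoReversal₆.d35 d refl)
cycle₆⇒rectangle north east north east south () d
cycle₆⇒rectangle north east north east north () d
cycle₆⇒rectangle north east north west east _ d = ⊥-elim (NoReversal₆.d35 d refl)
cycle₆⇒rectangle north east north west west () d
cycle₆⇒rectangle north east north west south _ d = ⊥-elim (NoReversal₆.d15 d refl)
cycle₆⇒rectangle north east north west north () d
cycle₆⇒rectangle north east north south _ _ d = ⊥-elim (NoReversal₆.d24 d refl)
cycle₆⇒rectangle north east north north east () d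
cycle₆⇒rectangle north east north north west () d
cycle₆⇒rectangle north east north north south _ d = ⊥-elim (NoReversal₆.d35 d refl)
cycle₆⇒rectangle north east north north north () d
cycle₆⇒rectangle north west east _ _ _ d = ⊥-elim (NoReversal₆.d13 d refl)
cycle₆⇒rectangle north west west east _ _ d = ⊥-elim (NoReversal₆.d24 d refl)
cycle₆⇒rectangle north west west west east _ d = ⊥-elim (NoReversal₆.d35 d refl)
cycle₆⇒rectangle north west west west west () d
cycle₆⇒rectangle north west west west south () d
cycle₆⇒rectangle north west west west north () d
cycle₆⇒rectangle north west west south east east d = wide , (λ ()) , _ , _ , (wide-12 , wide-02 , wide-01 , wide-00 , wide-10 , wide-11) , (λ { wide-00 → i3; wide-01 → i2; wide-02 → i1; wide-10 → i4; wide-11 → i5; wide-12 → i0 })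
cycle₆⇒rectangle north west west south west () d
cycle₆⇒rectangle north west west south south () d
cycle₆⇒rectangle north west west south north _ d = ⊥-elim (NoReversal₆.d35 d refl)
cycle₆⇒rectangle north west west north east () d
cycle₆⇒rectangle north west west north west () d
cycle₆⇒rectangle north west west north south _ d = ⊥-elim (NoReversal₆.d35 d refl)
cycle₆⇒rectangle north west west north north () d
cycle₆⇒rectangle north west south east _ _ d = ⊥-elim (NoReversal₆.d04 d refl)
cycle₆⇒rectangle north west south west east _ d = ⊥-elim (NoReversal₆.d35 d refl)
cycle₆⇒rectangle north west south west west () d
cycle₆⇒rectangle north west south west south () d
cycle₆⇒rectangle north west south west north () d
cycle₆⇒rectangle north west south south east north d = tall , (λ ()) , _ , _ , (tall-11 , tall-01 , tall-00 , tall-10 , tall-20 , tall-21) , (λ { tall-00 → i2; tall-01 → i1; tall-10 → i3; tall-11 → i0; tall-20 → i4; tall-21 → i5 })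
cycle₆⇒rectangle north west south south west () d
cycle₆⇒rectangle north west south south south () d
cycle₆⇒rectangle north west south south north _ d = ⊥-elim (NoReversal₆.d35 d refl)
cycle₆⇒rectangle north west south north _ _ d = ⊥-elim (NoReversal₆.d24 d refl)
cycle₆⇒rectangle north west north east east () d
cycle₆⇒rectangle north west north east west _ d = ⊥-elim (NoReversal₆.d35 d refl)
cycle₆⇒rectangle north west north east south _ d = ⊥-elim (NoReversal₆.d15 d refl)
cycle₆⇒rectangle north west north east north () d
cycle₆⇒rectangle north west north west east _ d = ⊥-elim (NoReversal₆.d35 d refl)
cycle₆⇒rectangle north west north west west () d
cycle₆⇒rectangle north west north west south () d
cycle₆⇒rectangle north west north west north () d
cycle₆⇒rectangle north west north south _ _ d = ⊥-elim (NoReversal₆.d24 d refl)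
cycle₆⇒rectangle north west north north east () d
cycle₆⇒rectangle north west north north west () d
cycle₆⇒rectangle north west north north south _ d = ⊥-elim (NoReversal₆.d35 d refl)
cycle₆⇒rectangle north west north north north () d
cycle₆⇒rectangle north south _ _ _ _ d = ⊥-elim (NoReversal₆.d02 d refl)
cycle₆⇒rectangle north north east east east () d
cycle₆⇒rectangle north north east east west _ d = ⊥-elim (NoReversal₆.d35 d refl)
cycle₆⇒rectangle north north east east south () d
cycle₆⇒rectangle north north east east north () d
cycle₆⇒rectangle north north east west _ _ d = ⊥-elim (NoReversal₆.d24 d refl)
cycle₆⇒rectangle north north east south east () d
cycle₆⇒rectangle north north east south west _ d = ⊥-elim (NoReversal₆.d15 d refl)
cycle₆⇒rectangle north north east south south west d = tall , (λ ()) , _ , _ , (tall-20 , tall-10 , tall-00 , tall-01 , tall-11 , tall-21) , (λ { tall-00 → i2; tall-01 → i3; tall-10 → i1; tall-11 → i4; tall-20 → i0; tall-21 → i5 })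
cycle₆⇒rectangle north north east south north _ d = ⊥-elim (NoReversal₆.d35 d refl)
cycle₆⇒rectangle north north east north east () d
cycle₆⇒rectangle north north east north west () d
cycle₆⇒rectangle north north east north south _ d = ⊥-elim (NoReversal₆.d35 d refl)
cycle₆⇒rectangle north north east north north () d
cycle₆⇒rectangle north north west east _ _ d = ⊥-elim (NoReversal₆.d24 d refl)
cycle₆⇒rectangle north north west west east _ d = ⊥-elim (NoReversal₆.d35 d refl)
cycle₆⇒rectangle north north west west west () d
cycle₆⇒rectangle north north west west south () d
cycle₆⇒rectangle north north west west north () d
cycle₆⇒rectangle north north west south east _ d = ⊥-elim (NoReversal₆.d15 d refl)
cycle₆⇒rectangle north north west south west () d
cycle₆⇒rectangle north north west south south east d = tall , (λ ()) , _ , _ , (tall-21 , tall-11 , tall-01 , tall-00 , tall-10 , tall-20) , (λ { tall-00 → i3; tall-01 → i2; tall-10 → i4; tall-11 → i1; tall-20 → i5; tall-21 → i0 })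
cycle₆⇒rectangle north north west south north _ d = ⊥-elim (NoReversal₆.d35 d refl)
cycle₆⇒rectangle north north west north east () d
cycle₆⇒rectangle north north west north west () d
cycle₆⇒rectangle north north west north south _ d = ⊥-elim (NoReversal₆.d35 d refl)
cycle₆⇒rectangle north north west north north () d
cycle₆⇒rectangle north north south _ _ _ d = ⊥-elim (NoReversal₆.d13 d refl)
cycle₆⇒rectangle north north north east east () d
cycle₆⇒rectangle north north north east west _ d = ⊥-elim (NoReversal₆.d35 d refl)
cycle₆⇒rectangle north north north east south () d
cycle₆⇒rectangle north north north east north () d
cycle₆⇒rectangle north north north west east _ d = ⊥-elim (NoReversal₆.d35 d refl)
cycle₆⇒rectangle north north north west west () d
cycle₆⇒rectangle north north north west south () d
cycle₆⇒rectangle north north north west north () d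
cycle₆⇒rectangle north north north south _ _ d = ⊥-elim (NoReversal₆.d24 d refl)
cycle₆⇒rectangle north north north north east () d
cycle₆⇒rectangle north north north north west () d
cycle₆⇒rectangle north north north north south _ d = ⊥-elim (NoReversal₆.d35 d refl)
cycle₆⇒rectangle north north north north north () d

step-suc-row : ∀ {a b c d} → Step (a , c) (b , d) → Step (suc a , c) (suc b , d)
step-suc-row east  = east
step-suc-row west  = west
step-suc-row south = south
step-suc-row north = north

step-suc-col : ∀ {a b c d} → Step (a , c) (b , d) → Step (a , suc c) (b , suc d)
step-suc-col east  = east
step-suc-col west  = west
step-suc-col south = south
step-suc-col north = north

horizontal-step : ∀ x c d → ∣ c - d ∣ ≡ 1 → Step (x , c) (x , d)
horizontal-step x zero          (suc zero)    _  = east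
horizontal-step x (suc zero)    zero          _  = west
horizontal-step x (suc c)       (suc d)       e  = step-suc-col (horizontal-step x c d e)
horizontal-step x zero          zero          ()
horizontal-step x zero          (suc (suc d)) ()
horizontal-step x (suc (suc c)) zero          ()

adjacent⇒step : ∀ a b c d → ∣ a - b ∣ + ∣ c - d ∣ ≡ 1 → Step (a , c) (b , d)
adjacent⇒step zero          zero          c d e = horizontal-step zero c d e
adjacent⇒step zero          (suc zero)    c d e rewrite ∣m-n∣≡0⇒m≡n {c} {d} (suc-injective e) = south
adjacent⇒step (suc zero)    zero          c d e rewrite ∣m-n∣≡0⇒m≡n {c} {d} (suc-injective e) = north
adjacent⇒step (suc a)       (suc b)       c d e = step-suc-row (adjacent⇒step a b c d e)
adjacent⇒step zero          (suc (suc b)) c d ()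
adjacent⇒step (suc (suc a)) zero          c d ()

module Tiling {m n : ℕ} (g : GraphDerangement (Vtx m n) (GAdj m n))
              (cycle₄⊎₆ : ∀ v → CycleLength (fun g) v 4 ⊎ CycleLength (fun g) v 6) where

  private
    V : Set
    V = Vtx m n
    F : V → V
    F = fun g

  pos : V → ℕ × ℕ
  pos (x , y) = toℕ x , toℕ y

  pos-injective : ∀ {u w} → pos u ≡ pos w → u ≡ w
  pos-injective {_ , _} {_ , _} e = cong₂ _,_ (toℕ-injective (cong proj₁ e)) (toℕ-injective (cong proj₂ e))

  walk : V → ℕ → ℕ × ℕ
  walk v i = pos (iter F i v)

  walk-step : ∀ v i → Step (walk v i) (walk v (suc i))
  walk-step v i with iter F i v
  ... | x , y = adjacent⇒step _ _ _ _ (adj g (x , y))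

  walk-closes : ∀ {v k} → CycleLength F v (suc k) → Step (walk v k) (walk v 0)
  walk-closes {v} {k} (_ , period , _) = subst (λ w → Step (walk v k) (pos w)) period (walk-step v k)

  walk-distinct : ∀ {v s} → CycleLength F v s → ∀ i j → {True (i <? j)} → {True (j <? s)} → walk v i ≢ walk v j
  walk-distinct cyc i j {i<j} {j<s} e = orbit-distinct F cyc (toWitness i<j) (toWitness j<s) (pos-injective e)

  record Traces (v : V) (R : Rect) : Set where
    field
      orbit⊆ : ∀ t → R ∋ walk v t
      ⊆orbit : ∀ {q} → R ∋ q → ∃ λ i → walk v i ≡ q

  traces : ∀ {v s R} → CycleLength F v s → (∀ i → i < s → R ∋ walk v i) → (∀ {q} → R ∋ q → ∃ λ i → walk v i ≡ q) → Traces v R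
  traces {v} {R = R} cyc cells onWalk = record { orbit⊆ = orbit⊆ ; ⊆orbit = onWalk }
    where
    orbit⊆ : ∀ t → R ∋ walk v t
    orbit⊆ t with iter-mod F cyc t
    ... | i , i<s , e = subst (λ w → R ∋ pos w) (sym e) (cells i i<s)

  square-traced : ∀ {v} → CycleLength F v 4 → Σ Rect λ R → shape R ≡ square × Traces v R
  square-traced {v} cyc
    with cycle₄⇒square (walk-step v 0) (walk-step v 1) (walk-step v 2) (walk-closes cyc)
                       (record { d02 = walk-distinct cyc 0 2 ; d13 = walk-distinct cyc 1 3 })
  ... | a , b , (c0 , c1 , c2 , c3) , exhaust = rect square a b , refl , traces cyc cells (onWalk ∘ exhaust)
    where
    cells : ∀ i → i < 4 → rect square a b ∋ walk v i
    cells 0 _ = c0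
    cells 1 _ = c1
    cells 2 _ = c2
    cells 3 _ = c3
    cells (suc (suc (suc (suc _)))) (s≤s (s≤s (s≤s (s≤s ()))))
    onWalk : ∀ {q} → In₄ (walk v 0) (walk v 1) (walk v 2) (walk v 3) q → ∃ λ i → walk v i ≡ q
    onWalk i0 = 0 , refl
    onWalk i1 = 1 , refl
    onWalk i2 = 2 , refl
    onWalk i3 = 3 , refl

  rectangle-traced : ∀ {v} → CycleLength F v 6 → Σ Rect λ R → shape R ≢ square × Traces v R
  rectangle-traced {v} cyc
    with cycle₆⇒rectangle (walk-step v 0) (walk-step v 1) (walk-step v 2) (walk-step v 3) (walk-step v 4) (walk-closes cyc)
           (record { d02 = walk-distinct cyc 0 2 ; d13 = walk-distinct cyc 1 3 ; d24 = walk-distinct cyc 2 4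
                   ; d35 = walk-distinct cyc 3 5 ; d04 = walk-distinct cyc 0 4 ; d15 = walk-distinct cyc 1 5 })
  ... | s , s≢square , a , b , (c0 , c1 , c2 , c3 , c4 , c5) , exhaust = rect s a b , s≢square , traces cyc cells (onWalk ∘ exhaust)
    where
    cells : ∀ i → i < 6 → rect s a b ∋ walk v i
    cells 0 _ = c0
    cells 1 _ = c1
    cells 2 _ = c2
    cells 3 _ = c3
    cells 4 _ = c4
    cells 5 _ = c5
    cells (suc (suc (suc (suc (suc (suc _)))))) (s≤s (s≤s (s≤s (s≤s (s≤s (s≤s ()))))))
    onWalk : ∀ {q} → In₆ (walk v 0) (walk v 1) (walk v 2) (walk v 3) (walk v 4) (walk v 5) q → ∃ λ i → walk v i ≡ q
    onWalk i0 = 0 , refl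
    onWalk i1 = 1 , refl
    onWalk i2 = 2 , refl
    onWalk i3 = 3 , refl
    onWalk i4 = 4 , refl
    onWalk i5 = 5 , refl

  opaque
    tiling : ∀ v → Σ Rect λ R → Traces v R × (shape R ≡ square → CycleLength F v 4)
    tiling v with cycle₄⊎₆ v
    ... | inj₁ cyc with square-traced cyc
    ...   | R , _ , tr = R , tr , λ _ → cyc
    tiling v | inj₂ cyc with rectangle-traced cyc
    ...   | R , s≢square , tr = R , tr , ⊥-elim ∘ s≢square

  tile : V → Rect
  tile v = proj₁ (tiling v)

  open Traces

  tile-traces : ∀ v → Traces v (tile v)
  tile-traces v = proj₁ (proj₂ (tiling v))

  square-tile⇒cycle₄ : ∀ {v} → shape (tile v) ≡ square → CycleLength F v 4
  square-tile⇒cycle₄ {v} = proj₂ (proj₂ (tiling v))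

  tile∋pos : ∀ v → tile v ∋ pos v
  tile∋pos v = orbit⊆ (tile-traces v) 0

  cycle : ∀ v → ∃ λ s → CycleLength F v s
  cycle v with cycle₄⊎₆ v
  ... | inj₁ cyc = 4 , cyc
  ... | inj₂ cyc = 6 , cyc

  tile-orbit : ∀ {v w} → SameOrbit F v w → tile v ≡ tile w
  tile-orbit {v} {w} v~w@(t , refl) = rect-ext ⊆ ⊇
    where
    w~v : SameOrbit F w v
    w~v = orbit-sym F (proj₂ (cycle v)) v~w
    ⊆ : ∀ {q} → tile v ∋ q → tile w ∋ q
    ⊆ c with ⊆orbit (tile-traces v) c | w~v
    ... | i , refl | r , back = subst (λ x → tile w ∋ pos x) (trans (iter-+ F i r w) (cong (iter F i) back))
                                       (orbit⊆ (tile-traces w) (i + r))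
    ⊇ : ∀ {q} → tile w ∋ q → tile v ∋ q
    ⊇ c with ⊆orbit (tile-traces w) c
    ... | j , refl = subst (tile v ∋_) (cong pos (iter-+ F j t v)) (orbit⊆ (tile-traces v) (j + t))

  vertex-at : ∀ {v q} → tile v ∋ q → Σ V λ w → pos w ≡ q
  vertex-at {v} c with ⊆orbit (tile-traces v) c
  ... | i , e = iter F i v , e

  ∋pos⇒tile≡ : ∀ {v w q} → tile v ∋ q → pos w ≡ q → tile w ≡ tile v
  ∋pos⇒tile≡ {v} c refl with ⊆orbit (tile-traces v) c
  ... | i , e = sym (tile-orbit (i , pos-injective e))

  tiles-meet : ∀ {u v q} → tile u ∋ q → tile v ∋ q → tile u ≡ tile v
  tiles-meet cu cv with vertex-at cu
  ... | w , e = trans (sym (∋pos⇒tile≡ cu e)) (∋pos⇒tile≡ cv e)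

  ∋⇒bounded : ∀ {v x y} → tile v ∋ (x , y) → x < m × y < n
  ∋⇒bounded c with vertex-at c
  ... | (x , y) , refl = toℕ<n x , toℕ<n y

  wide-row⇒3∣n : (r : Fin m) → (∀ c → shape (tile (r , c)) ≡ wide) → 3 ∣ n
  wide-row⇒3∣n r wide-tiles = blocks-of-three⇒3∣n start start≤ ≤start+2 block<n block-start
    where
    vertex : ∀ c → c < n → V
    vertex c p = r , fromℕ< p
    pos-vertex : ∀ c p → pos (vertex c p) ≡ (toℕ r , c)
    pos-vertex c p = cong (toℕ r ,_) (toℕ-fromℕ< p)
    is-wide : ∀ c p → shape (tile (vertex c p)) ≡ wide
    is-wide c p = wide-tiles (fromℕ< p)
    start : ∀ c → c < n → ℕ
    start c p = col (tile (vertex c p))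
    own : ∀ c p → Cell wide (row (tile (vertex c p))) (start c p) (toℕ r , c)
    own c p = ∋⇒Cell (is-wide c p) (subst (tile (vertex c p) ∋_) (pos-vertex c p) (tile∋pos (vertex c p)))
    start≤ : ∀ c p → start c p ≤ c
    start≤ c p = proj₁ (wide-columns (own c p))
    ≤start+2 : ∀ c p → c ≤ 2 + start c p
    ≤start+2 c p = proj₂ (wide-columns (own c p))
    block<n : ∀ c p → 2 + start c p < n
    block<n c p = proj₂ (∋⇒bounded (Cell⇒∋ (is-wide c p) (wide-row (own c p) (m≤n+m _ 2) ≤-refl)))
    block-start : ∀ c c' p p' → start c p ≤ c' → c' ≤ 2 + start c p → start c' p' ≡ start c p
    block-start c c' p p' le₁ le₂ =
      cong col (∋pos⇒tile≡ (Cell⇒∋ (is-wide c p) (wide-row (own c p) le₁ le₂)) (pos-vertex c' p'))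

module HeightFour {n : ℕ} (g : GraphDerangement (Vtx 4 n) (GAdj 4 n))
                  (cycle₄⊎₆ : ∀ v → CycleLength (fun g) v 4 ⊎ CycleLength (fun g) v 6)
                  (one-4-cycle : ∀ u w → CycleLength (fun g) u 4 → CycleLength (fun g) w 4 → SameOrbit (fun g) u w)
  where

  open Tiling g cycle₄⊎₆

  tile∋row1⇒∋row0 : ∀ {v y} → tile v ∋ (1 , y) → tile v ∋ (0 , y)
  tile∋row1⇒∋row0 {v} {y} c with vertex-at c
  ... | (_ , y′) , e = subst (_∋ (0 , y)) (tiles-meet below c) top
    where
    top : tile (zero , y′) ∋ (0 , y)
    top = subst (λ z → tile (zero , y′) ∋ (0 , z)) (cong proj₂ e) (tile∋pos (zero , y′))
    below : tile (zero , y′) ∋ (1 , y)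
    below with vertical-neighbour top
    ... | inj₁ (_ , () , _)
    ... | inj₂ c₁ = c₁

  tile∋row2⇒∋row3 : ∀ {v y} → tile v ∋ (2 , y) → tile v ∋ (3 , y)
  tile∋row2⇒∋row3 {v} {y} c with vertex-at c
  ... | (_ , y′) , e = subst (_∋ (3 , y)) (tiles-meet above c) bottom
    where
    bottom : tile (# 3 , y′) ∋ (3 , y)
    bottom = subst (λ z → tile (# 3 , y′) ∋ (3 , z)) (cong proj₂ e) (tile∋pos (# 3 , y′))
    above : tile (# 3 , y′) ∋ (2 , y)
    above with vertical-neighbour bottom
    ... | inj₁ (_ , refl , c₂) = c₂
    ... | inj₂ c₄ with proj₁ (∋⇒bounded c₄)
    ...   | s≤s (s≤s (s≤s (s≤s ())))

  no-tall-tile-at : ∀ v a b → tile v ≡ rect tall a b → ⊥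
  no-tall-tile-at v zero b e =
    case subst (_∋ (3 , b)) e (tile∋row2⇒∋row3 (subst (_∋ (2 , b)) (sym e) tall-20)) of λ ()
  no-tall-tile-at v (suc zero) b e =
    case subst (_∋ (0 , b)) e (tile∋row1⇒∋row0 (subst (_∋ (1 , b)) (sym e) tall-00)) of λ ()
  no-tall-tile-at v (suc (suc a)) b e with proj₁ (∋⇒bounded (subst (_∋ (4 + a , b)) (sym e) tall-20))
  ... | s≤s (s≤s (s≤s (s≤s ())))

  no-tall-tile : ∀ v → shape (tile v) ≢ tall
  no-tall-tile v e = no-tall-tile-at v _ _ (cong (λ s → rect s (row (tile v)) (col (tile v))) e)

  row-meets-square : ¬ 3 ∣ n → (r : Fin 4) → ∃ λ c → shape (tile (r , c)) ≡ square
  row-meets-square ¬3∣n r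
    with ¬∀⟶∃¬ n (λ c → shape (tile (r , c)) ≡ wide) (λ c → wide? (shape (tile (r , c)))) (¬3∣n ∘ wide-row⇒3∣n r)
  ... | c , not-wide = c , ≢wide⇒≢tall⇒≡square not-wide (no-tall-tile (r , c))

  3∣width : 3 ∣ n
  3∣width = decidable-stable (3 ∣? n) λ ¬3∣n →
    let (c , top-square) = row-meets-square ¬3∣n zero
        (c′ , bottom-square) = row-meets-square ¬3∣n (# 3)
        same : tile (# 3 , c′) ≡ tile (zero , c)
        same = tile-orbit (one-4-cycle _ _ (square-tile⇒cycle₄ bottom-square) (square-tile⇒cycle₄ top-square))
    in square-height (∋⇒Cell top-square (tile∋pos (zero , c)))
                     (∋⇒Cell top-square (subst (_∋ (3 , toℕ c′)) same (tile∋pos (# 3 , c′))))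

multiplicity : ℕ → List ℕ → ℕ
multiplicity s xs = length (filter (_≟ s) xs)

multiplicity-↭ : ∀ {s xs ys} → xs ↭ ys → multiplicity s xs ≡ multiplicity s ys
multiplicity-↭ {s} p = ↭-length (filter-↭ (_≟ s) p)

module _ {A : Set} (g : A → ℕ) (s : ℕ) where

  private
    1≤multiplicity : ∀ {x xs} → x ∈ xs → g x ≡ s → 1 ≤ multiplicity s (map g xs)
    1≤multiplicity x∈ gx = nonempty (∈-filter⁺ (_≟ s) (∈-map⁺ g x∈) gx)
      where nonempty : ∀ {y : ℕ} {ys} → y ∈ ys → 1 ≤ length ys
            nonempty {ys = _ ∷ _} _ = s≤s z≤n

    multiplicity-head : ∀ {x} xs → g x ≡ s → multiplicity s (map g (x ∷ xs)) ≡ suc (multiplicity s (map g xs))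
    multiplicity-head xs gx = cong length (filter-accept (_≟ s) gx)

    multiplicity-∷ : ∀ x xs → multiplicity s (map g xs) ≤ multiplicity s (map g (x ∷ xs))
    multiplicity-∷ x xs with g x ≟ s
    ... | yes gx = ≤-trans (n≤1+n _) (≤-reflexive (sym (multiplicity-head xs gx)))
    ... | no ¬gx = ≤-reflexive (cong length (sym (filter-reject (_≟ s) ¬gx)))

    not-twice : ∀ {x xs y} → multiplicity s (map g (x ∷ xs)) ≤ 1 → g x ≡ s → y ∈ xs → g y ≡ s → ⊥
    not-twice {xs = xs} m≤1 gx y∈ gy with ≤-trans (1≤multiplicity y∈ gy) (≤-pred (subst (_≤ 1) (multiplicity-head xs gx) m≤1))
    ... | ()

  multiplicity≤1⇒unique : ∀ xs {p q} → multiplicity s (map g xs) ≤ 1 → p ∈ xs → q ∈ xs → g p ≡ s → g q ≡ s → p ≡ q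
  multiplicity≤1⇒unique (x ∷ xs) _   (here refl) (here refl) _  _  = refl
  multiplicity≤1⇒unique (x ∷ xs) m≤1 (here refl) (there q∈)  gx gq = ⊥-elim (not-twice m≤1 gx q∈ gq)
  multiplicity≤1⇒unique (x ∷ xs) m≤1 (there p∈)  (here refl) gp gx = ⊥-elim (not-twice m≤1 gx p∈ gp)
  multiplicity≤1⇒unique (x ∷ xs) m≤1 (there p∈)  (there q∈)  gp gq =
    multiplicity≤1⇒unique xs (≤-trans (multiplicity-∷ x xs) m≤1) p∈ q∈ gp gq

cycleLength∈parts : ∀ {V} {f : V → V} {λs} → HasCycleType f λs → ∀ v → ∃ λ s → s ∈ λs × CycleLength f v s
cycleLength∈parts {f = f} (_ , lengths , cover , _ , perm) v =
  let (p , p∈ , p~v) = cover v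
  in proj₂ p , ∈-resp-↭ perm (∈-map⁺ proj₂ p∈) , cycleLength-transfer f (All.lookup lengths p∈) p~v

simple-part⇒one-cycle : ∀ {V} {f : V → V} {λs s u w} → HasCycleType f λs → multiplicity s λs ≤ 1 →
                        CycleLength f u s → CycleLength f w s → SameOrbit f u w
simple-part⇒one-cycle {f = f} {s = s} {w = w} (reps , lengths , cover , _ , perm) m≤1 cu cw =
  let (p , p∈ , p~u) = cover _
      (q , q∈ , q~w) = cover _
      cp = All.lookup lengths p∈
      cq = All.lookup lengths q∈
      p≡q = multiplicity≤1⇒unique proj₂ s reps (subst (_≤ 1) (sym (multiplicity-↭ perm)) m≤1) p∈ q∈
              (cycleLength-unique f (cycleLength-transfer f cp p~u) cu)
              (cycleLength-unique f (cycleLength-transfer f cq q~w) cw)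
  in orbit-trans f (orbit-sym f cp p~u) (subst (λ r → SameOrbit f (proj₁ r) w) (sym p≡q) q~w)

∈sixes-and-four : ∀ j {x} → x ∈ replicate j 6 ++ 4 ∷ [] → x ≡ 4 ⊎ x ≡ 6
∈sixes-and-four zero    (here e)  = inj₁ e
∈sixes-and-four (suc j) (here e)  = inj₂ e
∈sixes-and-four (suc j) (there p) = ∈sixes-and-four j p

multiplicity-4-sixes-and-four : ∀ j → multiplicity 4 (replicate j 6 ++ 4 ∷ []) ≡ 1
multiplicity-4-sixes-and-four zero    = refl
multiplicity-4-sixes-and-four (suc j) = multiplicity-4-sixes-and-four j

sixes-and-four-even : ∀ j → All (λ p → (1 ≤ p) × (2 ∣ p)) (replicate j 6 ++ 4 ∷ [])
sixes-and-four-even j = ++⁺ (replicate⁺ j (s≤s z≤n , divides 3 refl)) ((s≤s z≤n , divides 2 refl) All.∷ All.[])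

sum-sixes-and-four : ∀ j → sum (replicate j 6 ++ 4 ∷ []) ≡ j * 6 + 4
sum-sixes-and-four zero    = refl
sum-sixes-and-four (suc j) = trans (cong (6 +_) (sum-sixes-and-four j)) (sym (+-assoc 6 (j * 6) 4))

sum-sixesAndFour : ∀ k → sum (sixesAndFour k) ≡ 4 * (6 * k + 4)
sum-sixesAndFour k = trans (sum-sixes-and-four (4 * k + 2)) (solve 1 (λ k → (con 4 :* k :+ con 2) :* con 6 :+ con 4 := con 4 :* (con 6 :* k :+ con 4)) refl k)
  where open +-*-Solver

3∤6k+4 : ∀ k → ¬ 3 ∣ 6 * k + 4
3∤6k+4 k 3∣6k+4 with ∣m+n∣m⇒∣n 3∣6k+4 (∣-trans (divides 2 refl) (m∣m*n k))
... | divides (suc (suc _)) ()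

no-sixesAndFour : ∀ k (f : GraphDerangement (Vtx 4 (6 * k + 4)) (GAdj 4 (6 * k + 4))) → ¬ HasCycleType (fun f) (sixesAndFour k)
no-sixesAndFour k f cycle-type = 3∤6k+4 k (HeightFour.3∣width f cycle₄⊎₆ one-4-cycle)
  where
  cycle₄⊎₆ : ∀ v → CycleLength (fun f) v 4 ⊎ CycleLength (fun f) v 6
  cycle₄⊎₆ v with cycleLength∈parts cycle-type v
  ... | s , s∈ , cyc with ∈sixes-and-four (4 * k + 2) s∈
  ...   | inj₁ refl = inj₁ cyc
  ...   | inj₂ refl = inj₂ cyc
  one-4-cycle : ∀ u w → CycleLength (fun f) u 4 → CycleLength (fun f) w 4 → SameOrbit (fun f) u w
  one-4-cycle _ _ = simple-part⇒one-cycle cycle-type (≤-reflexive (multiplicity-4-sixes-and-four (4 * k + 2)))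

proposition21 : (k : ℕ) →
    (∀ (f : GraphDerangement (Vtx 4 (6 * k + 4)) (GAdj 4 (6 * k + 4))) → ¬ HasCycleType (fun f) (sixesAndFour k)) × ¬ EvenUniversal 4 (6 * k + 4)
proposition21 k = no-sixesAndFour k , λ universal →
  let (f , cycle-type) = universal (sixesAndFour k) (sixes-and-four-even (4 * k + 2)) (sum-sixesAndFour k)
  in no-sixesAndFour k f cycle-type
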